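{- Let $G$ be a connected graph with diameter $D(G)\ge 6$. Then $\dim_k(K_1+G)=\operatorname{adim}_k(G)=\operatorname{adim}_k(\overline{G})$ for every $k\in\{1,\ldots,\mathcal{C}(G)\}$.
   Context: Graphs are finite and simple. $K_1+G$ is the join of a single vertex with $G$ (the new vertex is adjacent to all vertices of $G$); $\overline{G}$ is the complement. For a connected graph $X$, $\dim_k(X)$ is the minimum size of $S\subseteq V(X)$ such that every two distinct vertices $x,y$ admit at least $k$ vertices $w\in S$ with $d_X(x,w)\neq d_X(y,w)$. For a graph $H$, $S\subseteq V(H)$ is a $k$-adjacency generator if every two distinct $x,y$ satisfy $|((N_H(x)\triangledown N_H(y))\cup\{x,y\})\cap S|\ge k$ ($\triangledown$ = symmetric difference); $\operatorname{adim}_k(H)$ is its minimum cardinality. $\mathcal{C}(G)=\min_{x\neq y}|(N_G(x)\triangledown N_G(y))\cup\{x,y\}|$. -}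

module Defs where

open import Data.Nat using (ℕ; zero; suc; _≤_; _<_)
open import Data.Bool using (Bool; true; false; not; _∧_; _∨_; _xor_)
open import Data.Fin using (Fin; zero; suc; _≟_)
open import Data.Fin.Subset using (Subset; _∈_; _⊆_; ∣_∣; _∩_)
open import Data.Vec using (tabulate)
open import Data.Product using (Σ; ∃; _×_)
open import Relation.Nullary using (¬_)
open import Relation.Nullary.Decidable using (⌊_⌋)
open import Relation.Binary.PropositionalEquality using (_≡_; _≢_; refl) renaming (sym to ≡-sym)
open import Relation.Nullary using (yes; no)
open import Data.Empty using (⊥-elim)
open import Data.Bool.Properties using (∧-zeroʳ)

record Graph (n : ℕ) : Set where
  field
    adj    : Fin n → Fin n → Bool
    sym    : ∀ x y → adj x y ≡ adj y x
    irrefl : ∀ x → adj x x ≡ false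
open Graph public

_==_ : ∀ {n} → Fin n → Fin n → Bool
x == y = ⌊ x ≟ y ⌋

joinAdj : ∀ {n} → (Fin n → Fin n → Bool) → Fin (suc n) → Fin (suc n) → Bool
joinAdj a zero    zero    = false
joinAdj a zero    (suc _) = true
joinAdj a (suc _) zero    = true
joinAdj a (suc i) (suc j) = a i j

K1+ : ∀ {n} → Graph n → Graph (suc n)
K1+ {n} G = record { adj = joinAdj (adj G) ; sym = s ; irrefl = r }
  where
  s : ∀ x y → joinAdj (adj G) x y ≡ joinAdj (adj G) y x
  s zero    zero    = refl
  s zero    (suc _) = refl
  s (suc _) zero    = refl
  s (suc i) (suc j) = sym G i j
  r : ∀ x → joinAdj (adj G) x x ≡ false
  r zero    = refl
  r (suc i) = irrefl G i

compAdj : ∀ {n} → Graph n → Fin n → Fin n → Bool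
compAdj G x y = not (adj G x y) ∧ not (x == y)

==-sym : ∀ {n} (x y : Fin n) → (x == y) ≡ (y == x)
==-sym x y with x ≟ y | y ≟ x
... | yes _ | yes _ = refl
... | no  _ | no  _ = refl
... | yes p | no ¬q = ⊥-elim (¬q (≡-sym p))
... | no ¬p | yes q = ⊥-elim (¬p (≡-sym q))

==-refl : ∀ {n} (x : Fin n) → (x == x) ≡ true
==-refl x with x ≟ x
... | yes _ = refl
... | no ¬p = ⊥-elim (¬p refl)

complement : ∀ {n} → Graph n → Graph n
complement G = record { adj = compAdj G ; sym = s ; irrefl = r }
  where
  s : ∀ x y → compAdj G x y ≡ compAdj G y x
  s x y rewrite sym G x y | ==-sym x y = refl
  r : ∀ x → compAdj G x x ≡ false
  r x rewrite ==-refl x = ∧-zeroʳ (not (adj G x x))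

data Walk {n} (G : Graph n) : Fin n → Fin n → ℕ → Set where
  here : ∀ {x} → Walk G x x 0
  step : ∀ {x y z l} → adj G x y ≡ true → Walk G y z l → Walk G x z (suc l)

Dist : ∀ {n} → Graph n → Fin n → Fin n → ℕ → Set
Dist G x y d = Walk G x y d × (∀ l → l < d → ¬ Walk G x y l)

Connected : ∀ {n} → Graph n → Set
Connected G = ∀ x y → ∃ λ d → Walk G x y d

IsMinimum : (ℕ → Set) → ℕ → Set
IsMinimum P m = P m × (∀ m′ → P m′ → m ≤ m′)

IsMaximum : (ℕ → Set) → ℕ → Set
IsMaximum P m = P m × (∀ m′ → P m′ → m′ ≤ m)

IsDiameter : ∀ {n} → Graph n → ℕ → Set
IsDiameter G = IsMaximum (λ d → Σ _ λ x → Σ _ λ y → Dist G x y d)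

Resolves : ∀ {n} → Graph n → Fin n → Fin n → Fin n → Set
Resolves X x y w = ∀ a b → Dist X x w a → Dist X y w b → a ≢ b

IsKMetricGenerator : ∀ {n} → Graph n → ℕ → Subset n → Set
IsKMetricGenerator X k S =
  ∀ x y → x ≢ y →
    Σ (Subset _) λ T → T ⊆ S × k ≤ ∣ T ∣ × (∀ w → w ∈ T → Resolves X x y w)

IsKMetricDim : ∀ {n} → Graph n → ℕ → ℕ → Set
IsKMetricDim {n} X k =
  IsMinimum (λ m → Σ (Subset n) λ S → IsKMetricGenerator X k S × ∣ S ∣ ≡ m)

DiffSet : ∀ {n} → Graph n → Fin n → Fin n → Subset n
DiffSet G x y = tabulate λ z → (z == x) ∨ (z == y) ∨ (adj G x z xor adj G y z)

IsKAdjGenerator : ∀ {n} → Graph n → ℕ → Subset n → Set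
IsKAdjGenerator G k S = ∀ x y → x ≢ y → k ≤ ∣ DiffSet G x y ∩ S ∣

IsKAdjDim : ∀ {n} → Graph n → ℕ → ℕ → Set
IsKAdjDim {n} G k =
  IsMinimum (λ m → Σ (Subset n) λ S → IsKAdjGenerator G k S × ∣ S ∣ ≡ m)

IsC : ∀ {n} → Graph n → ℕ → Set
IsC G = IsMinimum (λ c → Σ _ λ x → Σ _ λ y → x ≢ y × ∣ DiffSet G x y ∣ ≡ c)

module Submission where

-- In K₁ + G any two vertices are at distance at most 2 via the apex, so a vertex z of G
-- resolves two vertices x, y of G exactly when z ∈ (N(x) ▽ N(y)) ∪ {x, y}, while the apex
-- resolves no such pair; hence k-metric generators of K₁ + G restrict to k-adjacency
-- generators of G. Conversely, the apex and a vertex i are resolved by every vertex of G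
-- outside N[i]. As D(G) ≥ 6, some two vertices a, b lie at distance ≥ 3 from i, and the
-- k vertices of a k-adjacency generator distinguishing a from b lie in N[a] ∪ N[b], hence
-- outside N[i]. Complementation does not change (N(x) ▽ N(y)) ∪ {x, y},
-- and k ≤ 𝒞(G) makes V(G) itself a k-adjacency generator, so all minima exist.

open import Defs
open import Data.Nat using (ℕ; zero; suc; _+_; _≤_; _<_; z≤n; s≤s; s≤s⁻¹; _≤?_)
open import Data.Nat.Properties using (≤-refl; ≤-trans; ≤-antisym; +-comm; +-mono-≤; ≮⇒≥; n≮n; n≤1+n; anyUpTo?)
import Data.Nat.Properties as ℕ
open import Data.Nat.Induction using (<-wellFounded)
open import Induction.WellFounded using (Acc; acc)
open import Data.Bool using (Bool; true; false; not; _∧_; _∨_; _xor_) renaming (_≟_ to _≟ᵇ_)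
open import Data.Bool.Properties using (not-¬)
open import Data.Fin using (Fin; zero; suc; _≟_)
open import Data.Fin.Properties using (all?; any?; suc-injective)
open import Data.Fin.Subset using (Subset; _∈_; _⊆_; ∣_∣; _∩_; ⊤)
open import Data.Fin.Subset.Properties
  using (_∈?_; anySubset?; p⊆q⇒∣p∣≤∣q∣; ∣p∣≤∣x∷p∣; x∈p∩q⁺; x∈p∩q⁻; drop-there; ∩-identityʳ; ∣⊤∣≡n)
open import Data.Vec using (_∷_; here; there)
open import Data.Vec.Properties using (lookup∘tabulate; []=⇒lookup; lookup⇒[]=; tabulate-cong)
open import Data.Product using (Σ; ∃; ∃₂; _×_; _,_; proj₁; proj₂)
open import Data.Sum using (_⊎_; inj₁; inj₂)
open import Data.Empty using (⊥; ⊥-elim)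
open import Function using (_∘_)
open import Relation.Nullary using (¬_; Dec; yes; no; ¬?)
open import Relation.Nullary.Decidable using (map′; _×-dec_; _→-dec_)
open import Relation.Binary.PropositionalEquality
  using (_≡_; _≢_; refl; cong; subst; trans) renaming (sym to ≡-sym)

private
  variable
    n : ℕ

module _ {H : Graph n} where

  adj-sym : ∀ {x y} → adj H x y ≡ true → adj H y x ≡ true
  adj-sym {x} {y} e = trans (sym H y x) e

  adj⇒≢ : ∀ {x y} → adj H x y ≡ true → x ≢ y
  adj⇒≢ {x} e refl with trans (≡-sym e) (irrefl H x)
  ... | ()

  walk₀⇒≡ : ∀ {x y} → Walk H x y 0 → x ≡ y
  walk₀⇒≡ here = refl

  walk₁⇒adj : ∀ {x y} → Walk H x y 1 → adj H x y ≡ true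
  walk₁⇒adj (step e here) = e

  _++ʷ_ : ∀ {x y z l m} → Walk H x y l → Walk H y z m → Walk H x z (l + m)
  here     ++ʷ v = v
  step e w ++ʷ v = step e (w ++ʷ v)

  reverse : ∀ {x y l} → Walk H x y l → Walk H y x l
  reverse here               = here
  reverse (step {l = l} e w) =
    subst (Walk H _ _) (+-comm l 1) (reverse w ++ʷ step (adj-sym e) here)

  Dist⇒≤ : ∀ {x y d l} → Dist H x y d → Walk H x y l → d ≤ l
  Dist⇒≤ (_ , shortest) w = ≮⇒≥ (λ l<d → shortest _ l<d w)

  Dist-unique : ∀ {x y a b} → Dist H x y a → Dist H x y b → a ≡ b
  Dist-unique da db = ≤-antisym (Dist⇒≤ da (proj₁ db)) (Dist⇒≤ db (proj₁ da))

  Dist-reverse : ∀ {x y d} → Dist H x y d → Dist H y x d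
  Dist-reverse (w , shortest) = reverse w , λ l l<d w′ → shortest l l<d (reverse w′)

  adj⇒Dist₁ : ∀ {x y} → adj H x y ≡ true → Dist H x y 1
  adj⇒Dist₁ e = step e here , λ { zero _ w → adj⇒≢ e (walk₀⇒≡ w) ; (suc _) (s≤s ()) _ }

  Dist₂ : ∀ {x y} → x ≢ y → adj H x y ≡ false → Walk H x y 2 → Dist H x y 2
  Dist₂ x≢y ¬adj w = w , λ
    { zero          _              w₀ → x≢y (walk₀⇒≡ w₀)
    ; (suc zero)    _              w₁ → not-¬ ¬adj (walk₁⇒adj w₁)
    ; (suc (suc _)) (s≤s (s≤s ())) _ }

  resolves-by-Dist : ∀ {x y w a b} → Dist H x w a → Dist H y w b → a ≢ b → Resolves H x y w
  resolves-by-Dist dx dy a≢b a′ b′ dx′ dy′ a′≡b′ =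
    a≢b (trans (Dist-unique dx dx′) (trans a′≡b′ (Dist-unique dy′ dy)))

  equidistant⇒¬Resolves : ∀ {x y w d} → Dist H x w d → Dist H y w d → ¬ Resolves H x y w
  equidistant⇒¬Resolves dx dy r = r _ _ dx dy refl

  Resolves-sym : ∀ {x y w} → Resolves H x y w → Resolves H y x w
  Resolves-sym r a b da db a≡b = r b a db da (≡-sym a≡b)

walk? : (H : Graph n) → ∀ x y l → Dec (Walk H x y l)
walk? H x y zero with x ≟ y
... | yes refl = yes here
... | no x≢y   = no (x≢y ∘ walk₀⇒≡)
walk? H x y (suc l) with any? (λ z → (adj H x z ≟ᵇ true) ×-dec walk? H z y l)
... | yes (_ , e , w) = yes (step e w)
... | no ¬w           = no λ { (step e w) → ¬w (_ , e , w) }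

Within : Graph n → ℕ → Fin n → Fin n → Set
Within H r x y = ∃ λ l → l ≤ r × Walk H x y l

module _ {H : Graph n} where

  Within-sym : ∀ {r x y} → Within H r x y → Within H r y x
  Within-sym (l , l≤r , w) = l , l≤r , reverse w

  Within-trans : ∀ {r s x y z} → Within H r x y → Within H s y z → Within H (r + s) x z
  Within-trans (l , l≤r , v) (m , m≤s , w) = l + m , +-mono-≤ l≤r m≤s , v ++ʷ w

  Within-weaken : ∀ {r s x y} → r ≤ s → Within H r x y → Within H s x y
  Within-weaken r≤s (l , l≤r , w) = l , ≤-trans l≤r r≤s , w

  Dist⇒≤Within : ∀ {x y d r} → Dist H x y d → Within H r x y → d ≤ r
  Dist⇒≤Within d (_ , l≤r , w) = ≤-trans (Dist⇒≤ d w) l≤r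

  ¬Within₁⇒nonadjacent : ∀ {x y} → ¬ Within H 1 x y → x ≢ y × adj H x y ≡ false
  ¬Within₁⇒nonadjacent {x} {y} far = (λ { refl → far (0 , z≤n , here) }) , nonadjacent
    where
    nonadjacent : adj H x y ≡ false
    nonadjacent with adj H x y in e
    ... | true  = ⊥-elim (far (1 , s≤s z≤n , step e here))
    ... | false = refl

within? : (H : Graph n) → ∀ r x y → Dec (Within H r x y)
within? H r x y =
  map′ (λ (l , l<1+r , w) → l , s≤s⁻¹ l<1+r , w) (λ (l , l≤r , w) → l , s≤s l≤r , w)
       (anyUpTo? (walk? H x y) (suc r))

DistantPair : Graph n → Fin n → Set
DistantPair H i = ∃₂ λ a b → a ≢ b × ¬ Within H 2 i a × ¬ Within H 2 i b

module _ {G : Graph n} where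

  -- If i is near the end p of a geodesic of length ≥ 6 from q, then q and its
  -- successor on that geodesic are both far from i.
  distantPair-near-geodesic-end : ∀ {D i p q} → 6 ≤ D → Dist G q p D → Within G 2 i p → DistantPair G i
  distantPair-near-geodesic-end {i = i} {p} {q} 6≤D d@(step {y = q′} e _ , _) i⇝p =
    q , q′ , adj⇒≢ {H = G} e , far-q , far-q′
    where
    too-close : Within G 5 q p → ⊥
    too-close w = n≮n 5 (≤-trans 6≤D (Dist⇒≤Within d w))
    far-q : ¬ Within G 2 i q
    far-q i⇝q = too-close (Within-weaken (n≤1+n 4) (Within-trans (Within-sym i⇝q) i⇝p))
    far-q′ : ¬ Within G 2 i q′
    far-q′ i⇝q′ = too-close (Within-trans (1 , ≤-refl , step e here) (Within-trans (Within-sym i⇝q′) i⇝p))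

  diameter≥6⇒DistantPair : ∀ {D u v} → Dist G u v D → 6 ≤ D → ∀ i → DistantPair G i
  diameter≥6⇒DistantPair {u = u} {v} d 6≤D i with within? G 2 i u | within? G 2 i v
  ... | yes i⇝u  | _        = distantPair-near-geodesic-end 6≤D (Dist-reverse d) i⇝u
  ... | no _     | yes i⇝v  = distantPair-near-geodesic-end 6≤D d i⇝v
  ... | no far-u | no far-v = u , v , u≢v , far-u , far-v
    where
    u≢v : u ≢ v
    u≢v refl = n≮n 0 (≤-trans (s≤s z≤n) (≤-trans 6≤D (Dist⇒≤ d here)))

diffBit : Graph n → Fin n → Fin n → Fin n → Bool
diffBit G x y z = (z == x) ∨ (z == y) ∨ (adj G x z xor adj G y z)

module _ {G : Graph n} {x y z : Fin n} where

  ∈DiffSet⇒diffBit : z ∈ DiffSet G x y → diffBit G x y z ≡ true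
  ∈DiffSet⇒diffBit m = trans (≡-sym (lookup∘tabulate (diffBit G x y) z)) ([]=⇒lookup m)

  diffBit⇒∈DiffSet : diffBit G x y z ≡ true → z ∈ DiffSet G x y
  diffBit⇒∈DiffSet e = lookup⇒[]= z _ (trans (lookup∘tabulate (diffBit G x y) z) e)

  DiffSet⊆balls₁ : z ∈ DiffSet G x y → Within G 1 x z ⊎ Within G 1 y z
  DiffSet⊆balls₁ m with z ≟ x | z ≟ y | adj G x z in ex | adj G y z in ey | ∈DiffSet⇒diffBit m
  ... | yes refl | _        | _     | _     | _ = inj₁ (0 , z≤n , here)
  ... | no _     | yes refl | _     | _     | _ = inj₂ (0 , z≤n , here)
  ... | no _     | no _     | true  | _     | _ = inj₁ (1 , ≤-refl , step ex here)
  ... | no _     | no _     | false | true  | _ = inj₂ (1 , ≤-refl , step ey here)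
  ... | no _     | no _     | false | false | ()

module _ {G : Graph n} {a b i z : Fin n} where

  DiffSet-of-distantPair : ¬ Within G 2 i a → ¬ Within G 2 i b → z ∈ DiffSet G a b →
                           i ≢ z × adj G i z ≡ false
  DiffSet-of-distantPair far-a far-b m = ¬Within₁⇒nonadjacent (near-z (DiffSet⊆balls₁ m))
    where
    near-z : Within G 1 a z ⊎ Within G 1 b z → ¬ Within G 1 i z
    near-z (inj₁ a⇝z) i⇝z = far-a (Within-trans i⇝z (Within-sym a⇝z))
    near-z (inj₂ b⇝z) i⇝z = far-b (Within-trans i⇝z (Within-sym b⇝z))

DiffSet-complement : ∀ (G : Graph n) x y → DiffSet (complement G) x y ≡ DiffSet G x y
DiffSet-complement G x y = tabulate-cong pointwise
  where
  xor-complement : ∀ e₁ e₂ a₁ a₂ →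
    (e₁ ∨ e₂ ∨ ((not a₁ ∧ not e₁) xor (not a₂ ∧ not e₂))) ≡ (e₁ ∨ e₂ ∨ (a₁ xor a₂))
  xor-complement true  _     _     _     = refl
  xor-complement false true  _     _     = refl
  xor-complement false false true  true  = refl
  xor-complement false false true  false = refl
  xor-complement false false false true  = refl
  xor-complement false false false false = refl
  pointwise : ∀ z → diffBit (complement G) x y z ≡ diffBit G x y z
  pointwise z rewrite ==-sym x z | ==-sym y z =
    xor-complement (z == x) (z == y) (adj G x z) (adj G y z)

distanceCode : Bool → Bool → ℕ
distanceCode true  _     = 0
distanceCode false true  = 1
distanceCode false false = 2

-- In K₁ + G any two vertices of G are at distance at most 2, through the apex.
distK1+ : Graph n → Fin n → Fin n → ℕ
distK1+ G i z = distanceCode (z == i) (adj G i z)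

distanceCode-≢ : ∀ e₁ e₂ a₁ a₂ → (e₁ ∧ e₂) ≡ false → (e₁ ∨ e₂ ∨ (a₁ xor a₂)) ≡ true →
                 distanceCode e₁ a₁ ≢ distanceCode e₂ a₂
distanceCode-≢ true  true  _     _     ()
distanceCode-≢ true  false _     true  _ _ ()
distanceCode-≢ true  false _     false _ _ ()
distanceCode-≢ false true  true  _     _ _ ()
distanceCode-≢ false true  false _     _ _ ()
distanceCode-≢ false false true  false _ _ ()
distanceCode-≢ false false false true  _ _ ()
distanceCode-≢ false false true  true  _ ()
distanceCode-≢ false false false false _ ()

distanceCode-≡ : ∀ e₁ e₂ a₁ a₂ → (e₁ ∨ e₂ ∨ (a₁ xor a₂)) ≢ true → distanceCode e₁ a₁ ≡ distanceCode e₂ a₂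
distanceCode-≡ false false true  true  _    = refl
distanceCode-≡ false false false false _    = refl
distanceCode-≡ true  _     _     _     ¬bit = ⊥-elim (¬bit refl)
distanceCode-≡ false true  _     _     ¬bit = ⊥-elim (¬bit refl)
distanceCode-≡ false false true  false ¬bit = ⊥-elim (¬bit refl)
distanceCode-≡ false false false true  ¬bit = ⊥-elim (¬bit refl)

==∧==≡false : ∀ {x y : Fin n} z → x ≢ y → ((z == x) ∧ (z == y)) ≡ false
==∧==≡false {x = x} {y} z x≢y with z ≟ x | z ≟ y
... | yes refl | yes refl = ⊥-elim (x≢y refl)
... | yes _    | no _     = refl
... | no _     | _        = refl

module _ {G : Graph n} where

  Dist-K1+ : ∀ i z → Dist (K1+ G) (suc i) (suc z) (distK1+ G i z)
  Dist-K1+ i z with z ≟ i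
  ... | yes refl = here , λ _ ()
  ... | no z≢i with adj G i z in e
  ...   | true  = adj⇒Dist₁ e
  ...   | false = Dist₂ (z≢i ∘ ≡-sym ∘ suc-injective) e (step {y = zero} refl (step refl here))

  apex-¬Resolves : ∀ {i j} → ¬ Resolves (K1+ G) (suc i) (suc j) zero
  apex-¬Resolves = equidistant⇒¬Resolves (adj⇒Dist₁ refl) (adj⇒Dist₁ refl)

  nonadjacent-resolves-apex : ∀ {i z} → i ≢ z → adj G i z ≡ false → Resolves (K1+ G) zero (suc i) (suc z)
  nonadjacent-resolves-apex i≢z ¬adj =
    resolves-by-Dist (adj⇒Dist₁ refl)
      (Dist₂ (i≢z ∘ suc-injective) ¬adj (step {y = zero} refl (step refl here))) (λ ())

  ∈DiffSet⇒Resolves-K1+ : ∀ {i j z} → i ≢ j → z ∈ DiffSet G i j → Resolves (K1+ G) (suc i) (suc j) (suc z)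
  ∈DiffSet⇒Resolves-K1+ {i} {j} {z} i≢j m =
    resolves-by-Dist (Dist-K1+ i z) (Dist-K1+ j z)
      (distanceCode-≢ (z == i) (z == j) (adj G i z) (adj G j z) (==∧==≡false z i≢j) (∈DiffSet⇒diffBit {G = G} m))

  Resolves-K1+⇒∈DiffSet : ∀ {i j z} → Resolves (K1+ G) (suc i) (suc j) (suc z) → z ∈ DiffSet G i j
  Resolves-K1+⇒∈DiffSet {i} {j} {z} r with z ∈? DiffSet G i j
  ... | yes m = m
  ... | no z∉ = ⊥-elim (equidistant⇒¬Resolves (Dist-K1+ i z) dist-j r)
    where
    dist-j : Dist (K1+ G) (suc j) (suc z) (distK1+ G i z)
    dist-j = subst (Dist _ _ _)
      (≡-sym (distanceCode-≡ (z == i) (z == j) (adj G i z) (adj G j z) (z∉ ∘ diffBit⇒∈DiffSet {G = G})))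
      (Dist-K1+ j z)

module _ {G : Graph n} {k : ℕ} where

  resolvingSubset-K1+ : ∀ {x y} S (A : Subset n) → k ≤ ∣ A ∩ S ∣ →
    (∀ {z} → z ∈ A → Resolves (K1+ G) x y (suc z)) →
    Σ (Subset (suc n)) λ T → T ⊆ false ∷ S × k ≤ ∣ T ∣ × (∀ w → w ∈ T → Resolves (K1+ G) x y w)
  resolvingSubset-K1+ S A k≤ resolves =
      false ∷ (A ∩ S)
    , (λ { {suc _} (there m) → there (proj₂ (x∈p∩q⁻ _ _ m)) })
    , k≤
    , λ { (suc _) (there m) → resolves (proj₁ (x∈p∩q⁻ _ _ m)) }

  adjGenerator⇒metricGenerator-K1+ : (∀ i → DistantPair G i) → ∀ {S} →
    IsKAdjGenerator G k S → IsKMetricGenerator (K1+ G) k (false ∷ S)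
  adjGenerator⇒metricGenerator-K1+ _ gen zero zero x≢y = ⊥-elim (x≢y refl)
  adjGenerator⇒metricGenerator-K1+ _ {S} gen (suc i) (suc j) x≢y =
    resolvingSubset-K1+ S (DiffSet G i j) (gen i j i≢j) (∈DiffSet⇒Resolves-K1+ i≢j)
    where
    i≢j : i ≢ j
    i≢j = x≢y ∘ cong suc
  adjGenerator⇒metricGenerator-K1+ distant {S} gen zero (suc i) _ with distant i
  ... | a , b , a≢b , far-a , far-b =
    resolvingSubset-K1+ S (DiffSet G a b) (gen a b a≢b)
      (λ m → let (i≢z , ¬adj) = DiffSet-of-distantPair far-a far-b m
             in nonadjacent-resolves-apex i≢z ¬adj)
  adjGenerator⇒metricGenerator-K1+ distant {S} gen (suc i) zero _ with distant i
  ... | a , b , a≢b , far-a , far-b =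
    resolvingSubset-K1+ S (DiffSet G a b) (gen a b a≢b)
      (λ m → let (i≢z , ¬adj) = DiffSet-of-distantPair far-a far-b m
             in Resolves-sym (nonadjacent-resolves-apex i≢z ¬adj))

  metricGenerator-K1+⇒adjGenerator : ∀ {s S} →
    IsKMetricGenerator (K1+ G) k (s ∷ S) → IsKAdjGenerator G k S
  metricGenerator-K1+⇒adjGenerator {S = S} gen i j i≢j with gen (suc i) (suc j) (i≢j ∘ suc-injective)
  ... | true  ∷ _ , _  , _  , resolves = ⊥-elim (apex-¬Resolves (resolves zero here))
  ... | false ∷ T , T⊆ , k≤ , resolves = ≤-trans k≤ (p⊆q⇒∣p∣≤∣q∣ T⊆DiffSet∩S)
    where
    T⊆DiffSet∩S : T ⊆ DiffSet G i j ∩ S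
    T⊆DiffSet∩S m = x∈p∩q⁺ (Resolves-K1+⇒∈DiffSet (resolves _ (there m)) , drop-there (T⊆ (there m)))

  adjGenerator-complement : ∀ {S} → IsKAdjGenerator G k S → IsKAdjGenerator (complement G) k S
  adjGenerator-complement {S} gen x y x≢y =
    subst (λ A → k ≤ ∣ A ∩ S ∣) (≡-sym (DiffSet-complement G x y)) (gen x y x≢y)

  adjGenerator-uncomplement : ∀ {S} → IsKAdjGenerator (complement G) k S → IsKAdjGenerator G k S
  adjGenerator-uncomplement {S} gen x y x≢y =
    subst (λ A → k ≤ ∣ A ∩ S ∣) (DiffSet-complement G x y) (gen x y x≢y)

  ⊤-adjGenerator : ∀ {c} → IsC G c → k ≤ c → IsKAdjGenerator G k ⊤
  ⊤-adjGenerator (_ , c-min) k≤c x y x≢y =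
    subst (λ A → k ≤ ∣ A ∣) (≡-sym (∩-identityʳ (DiffSet G x y)))
      (≤-trans k≤c (c-min _ (x , y , x≢y , refl)))

minimum-exists : ∀ {P : ℕ → Set} → (∀ m → Dec (P m)) → ∀ {m} → P m → ∃ (IsMinimum P)
minimum-exists {P} P? {m} = go (<-wellFounded m)
  where
  go : ∀ {m} → Acc _<_ m → P m → ∃ (IsMinimum P)
  go {m} (acc smaller) pm with anyUpTo? P? m
  ... | yes (m′ , m′<m , pm′) = go (smaller m′<m) pm′
  ... | no none = m , pm , λ m′ pm′ → ≮⇒≥ λ m′<m → none (m′ , m′<m , pm′)

IsMinimum-transfer : ∀ {P Q : ℕ → Set} {m} → IsMinimum P m →
  (∀ {m} → P m → Q m) → (∀ {m} → Q m → ∃ λ m′ → m′ ≤ m × P m′) → IsMinimum Q m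
IsMinimum-transfer (pm , minimal) P⇒Q Q⇒P =
  P⇒Q pm , λ m″ qm″ → let (m′ , m′≤m″ , pm′) = Q⇒P qm″ in ≤-trans (minimal m′ pm′) m′≤m″

module _ (G : Graph n) (k : ℕ) where

  adjGeneratorOfSize? : ∀ m → Dec (Σ (Subset n) λ S → IsKAdjGenerator G k S × ∣ S ∣ ≡ m)
  adjGeneratorOfSize? m = anySubset? λ S → generator? S ×-dec (∣ S ∣ ℕ.≟ m)
    where
    generator? : ∀ S → Dec (IsKAdjGenerator G k S)
    generator? S = all? λ x → all? λ y → ¬? (x ≟ y) →-dec (k ≤? ∣ DiffSet G x y ∩ S ∣)

  adjDim-exists : ∀ {c} → IsC G c → k ≤ c → ∃ (IsKAdjDim G k)
  adjDim-exists C k≤c = minimum-exists adjGeneratorOfSize? (⊤ , ⊤-adjGenerator {G = G} C k≤c , ∣⊤∣≡n n)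

  adjDim-complement : ∀ {m} → IsKAdjDim G k m → IsKAdjDim (complement G) k m
  adjDim-complement adim = IsMinimum-transfer adim
    (λ (S , gen , ∣S∣≡m) → S , adjGenerator-complement {G = G} gen , ∣S∣≡m)
    (λ (S , gen , ∣S∣≡m) → _ , ≤-refl , S , adjGenerator-uncomplement {G = G} gen , ∣S∣≡m)

  adjDim⇒metricDim-K1+ : (∀ i → DistantPair G i) → ∀ {m} → IsKAdjDim G k m → IsKMetricDim (K1+ G) k m
  adjDim⇒metricDim-K1+ distant adim = IsMinimum-transfer adim
    (λ (S , gen , ∣S∣≡m) → false ∷ S , adjGenerator⇒metricGenerator-K1+ distant gen , ∣S∣≡m)
    (λ { (s ∷ S , gen , refl) → ∣ S ∣ , ∣p∣≤∣x∷p∣ s S , S , metricGenerator-K1+⇒adjGenerator gen , refl })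

lemma20 : ∀ {n} (G : Graph n) → Connected G →
    (Σ ℕ λ D → IsDiameter G D × 6 ≤ D) →
    ∀ k → 1 ≤ k → (Σ ℕ λ c → IsC G c × k ≤ c) →
    Σ ℕ λ m → IsKMetricDim (K1+ G) k m × IsKAdjDim G k m × IsKAdjDim (complement G) k m
lemma20 G _ (D , ((u , v , geodesic) , _) , 6≤D) k _ (c , C , k≤c)
  with adjDim-exists G k C k≤c
... | m , adim =
    m
  , adjDim⇒metricDim-K1+ G k (diameter≥6⇒DistantPair geodesic 6≤D) adim
  , adim
  , adjDim-complement G k adim
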